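{- For every sufficiently large $n$, there exists a function $\rho : \mathcal{S}_n \to \mathbb{R}_{\geq 0}$ such that $\sum_{\sigma \in \mathcal{S}_n : c_{ij} \in \sigma} \rho(\sigma) \geq 1$ for all $i,j \in \{1,\dots,n\}$ and \[ \sum_{\sigma \in \mathcal{S}_n} \rho(\sigma) < 0.925\, n . \] In particular, the optimal value of the linear program (LP$_c$) is less than $0.925\,n$.
   Context: For $n \geq 1$, $Q_n$ is the $n\times n$ chessboard in $[-1,1]^2$ whose cells are the closed squares $c_{ij} = \left[-1+(i-1)\frac 2n, -1+i\frac 2n\right] \times \left[-1+(j-1)\frac 2n, -1+j\frac 2n\right]$ for $i,j \in \{1,\dots,n\}$. A line $\ell$ pierces $c_{ij}$ if $\ell \cap \operatorname{int} c_{ij} \neq \emptyset$. For a line $\ell$, its snake $\sigma(\ell)$ is the set of cells of $Q_n$ pierced by $\ell$. Let $\mathcal{S}_n = \{\sigma(\ell) : \ell \text{ a line intersecting } [-1,1]^2\}$. The linear program (LP$_c$) is: minimize $\sum_{\sigma\in\mathcal{S}_n} \rho(\sigma)$ subject to $\rho(\sigma)\geq 0$ for all $\sigma$ and $\sum_{\sigma \ni c_{ij}} \rho(\sigma) \geq 1$ for every cell $c_{ij}$. -}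

module Defs where

open import Data.Nat using (ℕ)
open import Data.Integer as ℤ using (ℤ; +_; 0ℤ)
open import Data.Rational as ℚ using (ℚ; 0ℚ)
open import Data.Bool using (Bool; _∧_; T)
open import Data.List using (List; []; _∷_; foldr; map; filter)
open import Data.Bool.ListAction using (any)
open import Data.Product using (_×_; _,_; proj₁; proj₂)
open import Relation.Nullary using (¬_)
open import Relation.Nullary.Decidable using (⌊_⌋)
open import Relation.Binary.PropositionalEquality using (_≡_)

-- Grid coordinates: the affine bijection (x,y) ↦ (n(x+1)/2, n(y+1)/2) maps
-- [-1,1]^2 onto [0,n]^2 and the cell c_ij onto [i-1,i]×[j-1,j].
-- We index cells 0-based: cell (i,j) (i,j < n) is [i,i+1]×[j,j+1].

record Line : Set where
  field
    a b c  : ℤ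
    nondeg : ¬ (a ≡ 0ℤ × b ≡ 0ℤ)

open Line public

eval : Line → ℤ × ℤ → ℤ
eval ℓ (x , y) = (a ℓ ℤ.* x ℤ.+ b ℓ ℤ.* y) ℤ.- c ℓ

cellCorners : ℕ → ℕ → List (ℤ × ℤ)
cellCorners i j =
  (+ i , + j) ∷ (+ (ℕ.suc i) , + j) ∷ (+ i , + (ℕ.suc j)) ∷ (+ (ℕ.suc i) , + (ℕ.suc j)) ∷ []
  where import Data.Nat as ℕ

boardCorners : ℕ → List (ℤ × ℤ)
boardCorners n = (+ 0 , + 0) ∷ (+ n , + 0) ∷ (+ 0 , + n) ∷ (+ n , + n) ∷ []

-- The line pierces cell (i,j) (meets its open interior) iff the affine
-- function aX+bY-c is < 0 at some corner and > 0 at some corner.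
pierces : Line → ℕ → ℕ → Bool
pierces ℓ i j =
  any (λ p → ⌊ eval ℓ p ℤ.<? 0ℤ ⌋) (cellCorners i j) ∧
  any (λ p → ⌊ 0ℤ ℤ.<? eval ℓ p ⌋) (cellCorners i j)

MeetsBoard : ℕ → Line → Set
MeetsBoard n ℓ =
  T (any (λ p → ⌊ eval ℓ p ℤ.≤? 0ℤ ⌋) (boardCorners n) ∧
     any (λ p → ⌊ 0ℤ ℤ.≤? eval ℓ p ⌋) (boardCorners n))

-- A weighting: finite list of (line, weight). ρ(σ) is the total weight
-- of the listed lines whose snake is σ.
Weighting : Set
Weighting = List (Line × ℚ)

sumℚ : List ℚ → ℚ
sumℚ = foldr ℚ._+_ 0ℚ

totalWeight : Weighting → ℚ
totalWeight w = sumℚ (map proj₂ w)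

coverage : Weighting → ℕ → ℕ → ℚ
coverage w i j = sumℚ (map proj₂ (filter (λ e → T? (pierces (proj₁ e) i j)) w))
  where
  open import Data.Bool.Properties using (T?)

-- Write n = 4w + r and work in coordinates where the board is [0,n]² and the cells are unit
-- squares. Give weight 1/8 to: the midlines of the w outermost rows and columns on each side,
-- each taken twice; and the lines X ± Y = const at half-integer levels whose level lies in a
-- central window of 4w + 2r values, plus those in a broader window of 6w + 2r values. A slanted
-- line at half-integer level crosses two adjacent diagonals of cells, so each window containing
-- both lines through a cell contributes 2 hits, as does each outer row or column through it.
-- Because 4w ≤ n, a cell near one side is far from the opposite one; checking interior, edge
-- and corner cells (up to the symmetries of the square) gives at least 8 hits everywhere.
-- The total weight is (28w + 8r)/8 = 3.5w + r, which is below 0.925 (4w + r) once 3r < 8w,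
-- in particular for all n ≥ 8.
module Submission where

open import Data.Bool using (Bool; T; true; false)
open import Data.Bool.ListAction using (any)
open import Data.Bool.Properties using (T?; T-∧)
open import Data.Fin using (Fin; toℕ)
open import Data.Fin.Properties using (toℕ<n)
open import Data.Integer as ℤ using (ℤ; +_; +[1+_]; -[1+_]; 0ℤ; 1ℤ; -1ℤ; +≤+; +<+; -<+)
import Data.Integer.Properties as ℤP
import Data.Integer.Tactic.RingSolver as ℤ-Solver
open import Data.List using (List; []; _∷_; _++_; map; filter; length; replicate; iterate)
open import Data.List.Membership.Propositional using (_∈_)
open import Data.List.Properties using (filter-++; filter-all; length-++; length-map; length-iterate)
open import Data.List.Relation.Binary.Sublist.Heterogeneous.Properties using (length-mono-≤)
open import Data.List.Relation.Binary.Sublist.Propositional using (_⊆_; _∷_; _∷ʳ_)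
open import Data.List.Relation.Binary.Sublist.Propositional.Properties
  using ([]⊆-universal; filter⁺; map⁺; ++⁺; ++⁺ˡ; ++⁺ʳ)
open import Data.List.Relation.Unary.All as All using (All; []; _∷_)
import Data.List.Relation.Unary.All.Properties as AllP
open import Data.List.Relation.Unary.Any as Any using (here; there)
open import Data.List.Relation.Unary.Any.Properties using (any⁺)
open import Data.Nat using (ℕ; zero; suc; _+_; _*_; _≤_; _<_; _<?_; z≤n; s≤s; s≤s⁻¹)
open import Data.Nat.Coprimality using (1-coprimeTo) renaming (sym to coprime-sym)
open import Data.Nat.DivMod using (_%_; m≡m%n+[m/n]*n; m%n<n; /-monoˡ-≤) renaming (_/_ to _div_)
import Data.Nat.Properties as ℕP
open import Data.Nat.Tactic.RingSolver using (solve-∀)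
open import Data.Product using (∃-syntax; _×_; _,_; proj₁; proj₂; swap)
open import Data.Rational as ℚ using (ℚ; 0ℚ; 1ℚ; _/_; mkℚ; toℚᵘ)
import Data.Rational.Properties as ℚP
open import Data.Rational.Unnormalised as ℚᵘ using (mkℚᵘ; *≡*; *<*)
import Data.Rational.Unnormalised.Properties as ℚᵘP
open import Data.Sum as Sum using (_⊎_; inj₁; inj₂)
open import Function using (_∘_; id)
open import Function.Bundles using (Equivalence)
open import Relation.Binary.PropositionalEquality
  using (_≡_; refl; sym; trans; cong; cong₂; subst; subst₂)
open import Relation.Nullary using (¬_; yes; no; contradiction)
open import Relation.Nullary.Decidable using (⌊_⌋; fromWitness)
open import Relation.Unary using (Decidable)
open import Defs

record Direction : Set where
  constructor direction
  field
    p q     : ℤ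
    nonzero : ¬ (p ≡ 0ℤ × q ≡ 0ℤ)

open Direction

horizontal vertical antidiagonal diagonal : Direction
horizontal   = direction 0ℤ 1ℤ λ { (_ , ()) }
vertical     = direction 1ℤ 0ℤ λ { (() , _) }
antidiagonal = direction 1ℤ 1ℤ λ { (() , _) }
diagonal     = direction 1ℤ -1ℤ λ { (() , _) }

value : Direction → ℤ → ℤ × ℤ → ℤ
value d o (x , y) = p d ℤ.* x ℤ.+ q d ℤ.* y ℤ.+ o

-- The line pX + qY + o = t + 1/2, scaled by 2 to get integer coefficients. At a half-integer
-- level it passes through no lattice point, so it pierces a cell as soon as its level lies
-- between the values of pX + qY + o at two corners.
level : Direction → ℤ → ℕ → Line
level (direction p q nz) o t = record
  { a = + 2 ℤ.* p
  ; b = + 2 ℤ.* q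
  ; c = + 2 ℤ.* (+ t ℤ.- o) ℤ.+ 1ℤ
  ; nondeg = λ (2p≡0 , 2q≡0) →
      nz (ℤP.*-cancelˡ-≡ (+ 2) p 0ℤ 2p≡0 , ℤP.*-cancelˡ-≡ (+ 2) q 0ℤ 2q≡0)
  }

eval-level : ∀ d o t z → eval (level d o t) z ≡ + 2 ℤ.* (value d o z ℤ.- + t) ℤ.- 1ℤ
eval-level (direction p q _) o t (x , y) = identity p q o (+ t) x y
  where
  identity : ∀ p q o t x y →
    (+ 2 ℤ.* p ℤ.* x ℤ.+ + 2 ℤ.* q ℤ.* y) ℤ.- (+ 2 ℤ.* (t ℤ.- o) ℤ.+ 1ℤ)
      ≡ + 2 ℤ.* ((p ℤ.* x ℤ.+ q ℤ.* y ℤ.+ o) ℤ.- t) ℤ.- 1ℤ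
  identity = ℤ-Solver.solve-∀

2u-1<0 : ∀ {u} → u ℤ.≤ 0ℤ → + 2 ℤ.* u ℤ.- 1ℤ ℤ.< 0ℤ
2u-1<0 {+ 0}       _        = -<+
2u-1<0 { -[1+ _ ]} _        = -<+
2u-1<0 {+[1+ _ ]}  (+≤+ ())

0<2u-1 : ∀ {u} → 0ℤ ℤ.< u → 0ℤ ℤ.< + 2 ℤ.* u ℤ.- 1ℤ
0<2u-1 {+ 0}      (+<+ ())
0<2u-1 {+[1+ k ]} _        = +<+ (ℕP.m≤n⇒m≤o+n k (s≤s z≤n))

any-∈ : ∀ {A : Set} (f : A → Bool) {x xs} → x ∈ xs → T (f x) → T (any f xs)
any-∈ f x∈xs fx = any⁺ f (Any.map (λ { refl → fx }) x∈xs)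

pattern lower-left  = here refl
pattern lower-right = there (here refl)
pattern upper-left  = there (there (here refl))
pattern upper-right = there (there (there (here refl)))

module _ (d : Direction) (o : ℤ) {t : ℕ} where

  private
    ℓ = level d o t

  level-below : ∀ {z k} → value d o z ≡ + k → k ≤ t → eval ℓ z ℤ.< 0ℤ
  level-below {z} eq k≤t = subst (ℤ._< 0ℤ) (sym (eval-level d o t z))
    (2u-1<0 (ℤP.i≤j⇒i-j≤0 (subst (ℤ._≤ + t) (sym eq) (+≤+ k≤t))))

  level-above : ∀ {z k} → value d o z ≡ + k → t < k → 0ℤ ℤ.< eval ℓ z
  level-above {z} eq t<k = subst (0ℤ ℤ.<_) (sym (eval-level d o t z))
    (0<2u-1 (subst (ℤ._< value d o z ℤ.- + t) (ℤP.+-inverseʳ (+ t))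
      (ℤP.+-monoˡ-< (ℤ.- + t) (subst (+ t ℤ.<_) (sym eq) (+<+ t<k)))))

  level-pierces : ∀ {i j z₀ z₁ k₀ k₁} → z₀ ∈ cellCorners i j → z₁ ∈ cellCorners i j →
                  value d o z₀ ≡ + k₀ → k₀ ≤ t → value d o z₁ ≡ + k₁ → t < k₁ →
                  T (pierces ℓ i j)
  level-pierces {i} {j} z₀∈ z₁∈ eq₀ k₀≤t eq₁ t<k₁ = Equivalence.from T-∧ (below , above)
    where
    below : T (any (λ z → ⌊ eval ℓ z ℤ.<? 0ℤ ⌋) (cellCorners i j))
    below = any-∈ (λ z → ⌊ eval ℓ z ℤ.<? 0ℤ ⌋) z₀∈ (fromWitness (level-below eq₀ k₀≤t))
    above : T (any (λ z → ⌊ 0ℤ ℤ.<? eval ℓ z ⌋) (cellCorners i j))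
    above = any-∈ (λ z → ⌊ 0ℤ ℤ.<? eval ℓ z ⌋) z₁∈ (fromWitness (level-above eq₁ t<k₁))

  level-meets : ∀ {n z₀ z₁ k₀ k₁} → z₀ ∈ boardCorners n → z₁ ∈ boardCorners n →
                value d o z₀ ≡ + k₀ → k₀ ≤ t → value d o z₁ ≡ + k₁ → t < k₁ →
                MeetsBoard n ℓ
  level-meets {n} z₀∈ z₁∈ eq₀ k₀≤t eq₁ t<k₁ = Equivalence.from T-∧ (below , above)
    where
    below : T (any (λ z → ⌊ eval ℓ z ℤ.≤? 0ℤ ⌋) (boardCorners n))
    below = any-∈ (λ z → ⌊ eval ℓ z ℤ.≤? 0ℤ ⌋) z₀∈
              (fromWitness (ℤP.<⇒≤ (level-below eq₀ k₀≤t)))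
    above : T (any (λ z → ⌊ 0ℤ ℤ.≤? eval ℓ z ⌋) (boardCorners n))
    above = any-∈ (λ z → ⌊ 0ℤ ℤ.≤? eval ℓ z ⌋) z₁∈
              (fromWitness (ℤP.<⇒≤ (level-above eq₁ t<k₁)))

row col anti : ℕ → Line
row  = level horizontal 0ℤ
col  = level vertical 0ℤ
anti = level antidiagonal 0ℤ

-- X − Y + n = t + 1/2: the offset n makes the levels met by the board run over 0 ≤ t < 2n.
diag : ℕ → ℕ → Line
diag n = level diagonal (+ n)

row-value : ∀ x y → 0ℤ ℤ.* x ℤ.+ 1ℤ ℤ.* y ℤ.+ 0ℤ ≡ y
row-value = ℤ-Solver.solve-∀

col-value : ∀ x y → 1ℤ ℤ.* x ℤ.+ 0ℤ ℤ.* y ℤ.+ 0ℤ ≡ x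
col-value = ℤ-Solver.solve-∀

anti-value : ∀ x y → 1ℤ ℤ.* x ℤ.+ 1ℤ ℤ.* y ℤ.+ 0ℤ ≡ x ℤ.+ y
anti-value = ℤ-Solver.solve-∀

row-pierces : ∀ i j → T (pierces (row j) i j)
row-pierces i j = level-pierces horizontal 0ℤ {i = i} {j} lower-left upper-left
  (row-value (+ i) (+ j)) ℕP.≤-refl (row-value (+ i) (+ suc j)) ℕP.≤-refl

col-pierces : ∀ i j → T (pierces (col i) i j)
col-pierces i j = level-pierces vertical 0ℤ {i = i} {j} lower-left lower-right
  (col-value (+ i) (+ j)) ℕP.≤-refl (col-value (+ suc i) (+ j)) ℕP.≤-refl

anti-pierces : ∀ {a b t} → a + b ≤ t → t ≤ suc (a + b) → T (pierces (anti t) a b)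
anti-pierces {a} {b} {t} lo hi =
  level-pierces antidiagonal 0ℤ {i = a} {b} lower-left upper-right
    (anti-value (+ a) (+ b)) lo (anti-value (+ suc a) (+ suc b))
    (subst (t <_) (sym (ℕP.+-suc (suc a) b)) (s≤s hi))

diag-pierces : ∀ {n a b b' t} → suc (b + b') ≡ n → a + b' ≤ t → t ≤ suc (a + b') →
               T (pierces (diag n t) a b)
diag-pierces {a = a} {b} {b'} {t} refl lo hi =
  level-pierces diagonal (+ suc (b + b')) {i = a} {b} upper-left lower-right
    (upper-left-value (+ a) (+ b) (+ b')) lo (lower-right-value (+ a) (+ b) (+ b'))
    (subst (t <_) (sym (ℕP.+-suc (suc a) b')) (s≤s hi))
  where
  upper-left-value : ∀ x y z → 1ℤ ℤ.* x ℤ.+ -1ℤ ℤ.* (1ℤ ℤ.+ y) ℤ.+ ((1ℤ ℤ.+ y) ℤ.+ z)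
                               ≡ x ℤ.+ z
  upper-left-value = ℤ-Solver.solve-∀
  lower-right-value : ∀ x y z → 1ℤ ℤ.* (1ℤ ℤ.+ x) ℤ.+ -1ℤ ℤ.* y ℤ.+ ((1ℤ ℤ.+ y) ℤ.+ z)
                                ≡ (1ℤ ℤ.+ x) ℤ.+ (1ℤ ℤ.+ z)
  lower-right-value = ℤ-Solver.solve-∀

row-meets : ∀ {n t} → t < n → MeetsBoard n (row t)
row-meets {n} t<n = level-meets horizontal 0ℤ {n = n} lower-left upper-left
  (row-value (+ 0) (+ 0)) z≤n (row-value (+ 0) (+ n)) t<n

col-meets : ∀ {n t} → t < n → MeetsBoard n (col t)
col-meets {n} t<n = level-meets vertical 0ℤ {n = n} lower-left lower-right
  (col-value (+ 0) (+ 0)) z≤n (col-value (+ n) (+ 0)) t<n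

anti-meets : ∀ {n t} → t < n + n → MeetsBoard n (anti t)
anti-meets {n} t<2n = level-meets antidiagonal 0ℤ {n = n} lower-left upper-right
  (anti-value (+ 0) (+ 0)) z≤n (anti-value (+ n) (+ n)) t<2n

diag-meets : ∀ {n t} → t < n + n → MeetsBoard n (diag n t)
diag-meets {n} t<2n = level-meets diagonal (+ n) {n = n} upper-left lower-right
  (upper-left-value (+ n)) z≤n (lower-right-value (+ n)) t<2n
  where
  upper-left-value : ∀ y → 1ℤ ℤ.* 0ℤ ℤ.+ -1ℤ ℤ.* y ℤ.+ y ≡ 0ℤ
  upper-left-value = ℤ-Solver.solve-∀
  lower-right-value : ∀ x → 1ℤ ℤ.* x ℤ.+ -1ℤ ℤ.* 0ℤ ℤ.+ x ≡ x ℤ.+ x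
  lower-right-value = ℤ-Solver.solve-∀

uniform : ℚ → List Line → Weighting
uniform q = map (_, q)

pierces? : ∀ i j → Decidable (λ ℓ → T (pierces ℓ i j))
pierces? i j ℓ = T? (pierces ℓ i j)

-- Opaque, so that a bound on hits i j xs fixes xs when xs is left implicit.
opaque
  hits : ℕ → ℕ → List Line → ℕ
  hits i j = length ∘ filter (pierces? i j)

  hits-++ : ∀ i j xs ys → hits i j (xs ++ ys) ≡ hits i j xs + hits i j ys
  hits-++ i j xs ys =
    trans (cong length (filter-++ (pierces? i j) xs ys)) (length-++ (filter (pierces? i j) xs))

  hits-⊆ : ∀ {i j xs ys} → xs ⊆ ys → All (λ ℓ → T (pierces ℓ i j)) xs →
           length xs ≤ hits i j ys
  hits-⊆ {i} {j} {ys = ys} xs⊆ys pierced =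
    subst (_≤ hits i j ys) (cong length (filter-all (pierces? i j) pierced))
      (length-mono-≤ (filter⁺ (pierces? i j) (pierces? i j) (λ { refl → id }) xs⊆ys))

  coverage-uniform : ∀ q L i j → coverage (uniform q L) i j ≡ sumℚ (replicate (hits i j L) q)
  coverage-uniform q []      i j = refl
  coverage-uniform q (ℓ ∷ L) i j with pierces ℓ i j
  ... | true  = cong (q ℚ.+_) (coverage-uniform q L i j)
  ... | false = coverage-uniform q L i j

hits-++-mono : ∀ {i j k l xs ys} → k ≤ hits i j xs → l ≤ hits i j ys → k + l ≤ hits i j (xs ++ ys)
hits-++-mono {i} {j} {k} {l} {xs} {ys} k≤ l≤ =
  subst (k + l ≤_) (sym (hits-++ i j xs ys)) (ℕP.+-mono-≤ k≤ l≤)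

totalWeight-uniform : ∀ q L → totalWeight (uniform q L) ≡ sumℚ (replicate (length L) q)
totalWeight-uniform q []      = refl
totalWeight-uniform q (ℓ ∷ L) = cong (q ℚ.+_) (totalWeight-uniform q L)

sumℚ-replicate-nonNeg : ∀ {q} → 0ℚ ℚ.≤ q → ∀ m → 0ℚ ℚ.≤ sumℚ (replicate m q)
sumℚ-replicate-nonNeg 0≤q zero    = ℚP.≤-refl
sumℚ-replicate-nonNeg 0≤q (suc m) = ℚP.+-mono-≤ 0≤q (sumℚ-replicate-nonNeg 0≤q m)

sumℚ-replicate-mono : ∀ {q m m'} → 0ℚ ℚ.≤ q → m ≤ m' →
                      sumℚ (replicate m q) ℚ.≤ sumℚ (replicate m' q)
sumℚ-replicate-mono 0≤q (z≤n {m'})     = sumℚ-replicate-nonNeg 0≤q m'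
sumℚ-replicate-mono {q} 0≤q (s≤s m≤m') = ℚP.+-monoʳ-≤ q (sumℚ-replicate-mono 0≤q m≤m')

iterate-suc-⊆ : ∀ {a t k m} → a ≤ t → k + t ≤ a + m → iterate suc t k ⊆ iterate suc a m
iterate-suc-⊆ {k = zero} _ _ = []⊆-universal _
iterate-suc-⊆ {a} {t} {suc k} {zero} a≤t k+t≤a = contradiction a<a (ℕP.n≮n a)
  where
  a<a : a < a
  a<a = ℕP.≤-trans (s≤s (ℕP.m≤n⇒m≤o+n k a≤t)) (subst (suc k + t ≤_) (ℕP.+-identityʳ a) k+t≤a)
iterate-suc-⊆ {a} {t} {suc k} {suc m} a≤t k+t≤a+m with ℕP.m≤n⇒m<n∨m≡n a≤t
... | inj₁ a<t  = a ∷ʳ iterate-suc-⊆ a<t (subst (suc k + t ≤_) (ℕP.+-suc a m) k+t≤a+m)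
... | inj₂ refl = refl ∷ iterate-suc-⊆ ℕP.≤-refl
                           (subst₂ _≤_ (sym (ℕP.+-suc k a)) (ℕP.+-suc a m) k+t≤a+m)

All-iterate-suc : ∀ {P : ℕ → Set} {a m} → (∀ {t} → t < a + m → P t) → All P (iterate suc a m)
All-iterate-suc {a = a} {zero}  below = []
All-iterate-suc {a = a} {suc m} below =
  below (subst (a <_) (sym (ℕP.+-suc a m)) (s≤s (ℕP.m≤m+n a m)))
  ∷ All-iterate-suc (λ {t} → below ∘ subst (t <_) (sym (ℕP.+-suc a m)))

length-map-++ : ∀ (f g : ℕ → Line) xs ys → length (map f xs ++ map g ys) ≡ length xs + length ys
length-map-++ f g xs ys = trans (length-++ (map f xs)) (cong₂ _+_ (length-map f xs) (length-map g ys))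

Outer : ℕ → ℕ → ℕ → Set
Outer w x x' = x < w ⊎ x' < w

Band : ℕ → ℕ → ℕ → Set
Band d s s' = d ≤ s × d ≤ s'

-- For a cell (a, b) of the n × n board, a' = n − 1 − a and b' = n − 1 − b. The two antidiagonal
-- lines through the cell have levels a + b and a + b + 1, both in the window [d, 2n − d) iff
-- Band d (a + b) (a' + b'); likewise for the diagonal lines with b and b' exchanged. Each
-- constructor lists conditions worth 2 + 2 + 2 + 2 hits of the lines of the construction.
data Covering (w a a' b b' : ℕ) : Set where
  interior    : Band (2 * w) (a + b) (a' + b') → Band (2 * w) (a + b') (a' + b) →
                Covering w a a' b b'
  edge-anti   : Outer w a a' ⊎ Outer w b b' →
                Band (2 * w) (a + b) (a' + b') → Band w (a + b') (a' + b) → Covering w a a' b b'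
  edge-diag   : Outer w a a' ⊎ Outer w b b' →
                Band w (a + b) (a' + b') → Band (2 * w) (a + b') (a' + b) → Covering w a a' b b'
  corner-anti : Outer w a a' → Outer w b b' → Band (2 * w) (a + b) (a' + b') → Covering w a a' b b'
  corner-diag : Outer w a a' → Outer w b b' → Band (2 * w) (a + b') (a' + b) → Covering w a a' b b'

Covering-reflectˡ : ∀ {w a a' b b'} → Covering w a' a b b' → Covering w a a' b b'
Covering-reflectˡ (interior anti diag)     = interior (swap diag) (swap anti)
Covering-reflectˡ (edge-anti o anti diag)  = edge-diag (Sum.map₁ Sum.swap o) (swap diag) (swap anti)
Covering-reflectˡ (edge-diag o anti diag)  = edge-anti (Sum.map₁ Sum.swap o) (swap diag) (swap anti)
Covering-reflectˡ (corner-anti oa ob anti) = corner-diag (Sum.swap oa) ob (swap anti)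
Covering-reflectˡ (corner-diag oa ob diag) = corner-anti (Sum.swap oa) ob (swap diag)

Covering-reflectʳ : ∀ {w a a' b b'} → Covering w a a' b' b → Covering w a a' b b'
Covering-reflectʳ (interior anti diag)     = interior diag anti
Covering-reflectʳ (edge-anti o anti diag)  = edge-diag (Sum.map₂ Sum.swap o) diag anti
Covering-reflectʳ (edge-diag o anti diag)  = edge-anti (Sum.map₂ Sum.swap o) diag anti
Covering-reflectʳ (corner-anti oa ob anti) = corner-diag oa (Sum.swap ob) anti
Covering-reflectʳ (corner-diag oa ob diag) = corner-anti oa (Sum.swap ob) diag

Covering-transpose : ∀ {w a a' b b'} → Covering w b b' a a' → Covering w a a' b b'
Covering-transpose {a = a} {a'} {b} {b'} = λ where
    (interior anti diag)     → interior (commute b a b' a' anti) (swap (commute b a' b' a diag))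
    (edge-anti o anti diag)  → edge-anti (Sum.swap o) (commute b a b' a' anti) (swap (commute b a' b' a diag))
    (edge-diag o anti diag)  → edge-diag (Sum.swap o) (commute b a b' a' anti) (swap (commute b a' b' a diag))
    (corner-anti oa ob anti) → corner-anti ob oa (commute b a b' a' anti)
    (corner-diag oa ob diag) → corner-diag ob oa (swap (commute b a' b' a diag))
  where
  commute : ∀ {d} x y x' y' → Band d (x + y) (x' + y') → Band d (y + x) (y' + x')
  commute {d} x y x' y' (l , r) = subst (d ≤_) (ℕP.+-comm x y) l , subst (d ≤_) (ℕP.+-comm x' y') r

data Position (w x x' : ℕ) : Set where
  low    : x < w → Position w x x'
  high   : x' < w → Position w x x'
  middle : w ≤ x → w ≤ x' → Position w x x'

position : ∀ w x x' → Position w x x'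
position w x x' with x <? w | x' <? w
... | yes x<w | _        = low x<w
... | no _    | yes x'<w = high x'<w
... | no x≮w  | no x'≮w  = middle (ℕP.≮⇒≥ x≮w) (ℕP.≮⇒≥ x'≮w)

opposite-far : ∀ {w x} x' → 4 * w ≤ suc (x + x') → x < w → 2 * w ≤ x'
opposite-far {w} x' wide x<w = ℕP.≤-trans (ℕP.*-monoˡ-≤ w {2} {3} (s≤s (s≤s z≤n)))
  (ℕP.+-cancelˡ-≤ w (3 * w) x' (ℕP.≤-trans wide (ℕP.+-monoˡ-≤ x' x<w)))

some-half : ∀ w x x' → 4 * w ≤ suc (x + x') → 2 * w ≤ x ⊎ 2 * w ≤ x'
some-half w x x' wide with x <? 2 * w
... | no x≮2w  = inj₁ (ℕP.≮⇒≥ x≮2w)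
... | yes x<2w = inj₂ (ℕP.+-cancelˡ-≤ (2 * w) (2 * w) x'
        (ℕP.≤-trans (ℕP.≤-reflexive (sym (ℕP.*-distribʳ-+ w 2 2)))
                    (ℕP.≤-trans wide (ℕP.+-monoˡ-≤ x' x<2w))))

middle-sum : ∀ {w x y} → w ≤ x → w ≤ y → 2 * w ≤ x + y
middle-sum {w} {x} {y} w≤x w≤y =
  subst (_≤ x + y) (cong (λ v → w + v) (sym (ℕP.+-identityʳ w))) (ℕP.+-mono-≤ w≤x w≤y)

half≤ : ∀ w {x} → 2 * w ≤ x → w ≤ x
half≤ w = ℕP.≤-trans (ℕP.m≤m+n w (w + 0))

flip-wide : ∀ {w} x x' → 4 * w ≤ suc (x + x') → 4 * w ≤ suc (x' + x)
flip-wide {w} x x' = subst (λ m → 4 * w ≤ suc m) (ℕP.+-comm x x')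

module _ {w a a' b b' : ℕ} (wideˡ : 4 * w ≤ suc (a + a')) (wideʳ : 4 * w ≤ suc (b + b')) where

  corner-covering : a < w → b < w → Covering w a a' b b'
  corner-covering a<w b<w = corner-diag (inj₁ a<w) (inj₁ b<w)
    (ℕP.m≤n⇒m≤o+n a (opposite-far b' wideʳ b<w) , ℕP.m≤n⇒m≤n+o b (opposite-far a' wideˡ a<w))

  edge-covering : a < w → w ≤ b → w ≤ b' → Covering w a a' b b'
  edge-covering a<w w≤b w≤b' with some-half w b b' wideʳ
  ... | inj₁ 2w≤b  = edge-anti (inj₁ (inj₁ a<w))
          (ℕP.m≤n⇒m≤o+n a 2w≤b , ℕP.m≤n⇒m≤n+o b' far)
          (ℕP.m≤n⇒m≤o+n a w≤b' , ℕP.m≤n⇒m≤n+o b (half≤ w far))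
    where far = opposite-far a' wideˡ a<w
  ... | inj₂ 2w≤b' = edge-diag (inj₁ (inj₁ a<w))
          (ℕP.m≤n⇒m≤o+n a w≤b , ℕP.m≤n⇒m≤n+o b' (half≤ w far))
          (ℕP.m≤n⇒m≤o+n a 2w≤b' , ℕP.m≤n⇒m≤n+o b far)
    where far = opposite-far a' wideˡ a<w

interior-covering : ∀ {w a a' b b'} → w ≤ a → w ≤ a' → w ≤ b → w ≤ b' → Covering w a a' b b'
interior-covering w≤a w≤a' w≤b w≤b' =
  interior (middle-sum w≤a w≤b , middle-sum w≤a' w≤b') (middle-sum w≤a w≤b' , middle-sum w≤a' w≤b)

covering : ∀ {w a a' b b'} → 4 * w ≤ suc (a + a') → 4 * w ≤ suc (b + b') → Covering w a a' b b'
covering {w} {a} {a'} {b} {b'} wa wb with position w a a' | position w b b'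
... | low a<w         | low b<w         = corner-covering wa wb a<w b<w
... | low a<w         | high b'<w       = Covering-reflectʳ (corner-covering wa wb⁻ a<w b'<w)
  where wb⁻ = flip-wide {w} b b' wb
... | low a<w         | middle w≤b w≤b' = edge-covering wa wb a<w w≤b w≤b'
... | high a'<w       | low b<w         = Covering-reflectˡ (corner-covering wa⁻ wb a'<w b<w)
  where wa⁻ = flip-wide {w} a a' wa
... | high a'<w       | high b'<w       =
  Covering-reflectˡ (Covering-reflectʳ (corner-covering wa⁻ wb⁻ a'<w b'<w))
  where wa⁻ = flip-wide {w} a a' wa
        wb⁻ = flip-wide {w} b b' wb
... | high a'<w       | middle w≤b w≤b' = Covering-reflectˡ (edge-covering wa⁻ wb a'<w w≤b w≤b')
  where wa⁻ = flip-wide {w} a a' wa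
... | middle w≤a w≤a' | low b<w         = Covering-transpose (edge-covering wb wa b<w w≤a w≤a')
... | middle w≤a w≤a' | high b'<w       =
  Covering-reflectʳ (Covering-transpose (edge-covering wb⁻ wa b'<w w≤a w≤a'))
  where wb⁻ = flip-wide {w} b b' wb
... | middle w≤a w≤a' | middle w≤b w≤b' = interior-covering w≤a w≤a' w≤b w≤b'

window : ∀ {d len s s'} → d ≤ s' → 2 + (s + s') ≡ d + len + d → 2 + s ≤ d + len
window {d} {len} {s} d≤s' eq =
  ℕP.+-cancelʳ-≤ d (2 + s) (d + len)
    (ℕP.≤-trans (ℕP.+-monoʳ-≤ (2 + s) d≤s') (ℕP.≤-reflexive eq))

band-hits : ∀ (f : ℕ → Line) {i j d len s s'} → Band d s s' → 2 + (s + s') ≡ d + len + d →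
            T (pierces (f s) i j) → T (pierces (f (suc s)) i j) →
            2 ≤ hits i j (map f (iterate suc d len))
band-hits f (d≤s , d≤s') eq first second =
  hits-⊆ (map⁺ f (iterate-suc-⊆ d≤s (window d≤s' eq))) (first ∷ second ∷ [])

eighth : ℚ
eighth = + 1 / 8

0≤eighth : 0ℚ ℚ.≤ eighth
0≤eighth = ℚ.*≤* (+≤+ z≤n)

toℚᵘ-eighths : ∀ m → toℚᵘ (sumℚ (replicate m eighth)) ℚᵘ.≃ mkℚᵘ (+ m) 7
toℚᵘ-eighths zero    = *≡* refl
toℚᵘ-eighths (suc m) = ℚᵘP.≃-trans (ℚP.toℚᵘ-homo-+ eighth (sumℚ (replicate m eighth)))
  (ℚᵘP.≃-trans (ℚᵘP.+-congʳ (toℚᵘ eighth) (toℚᵘ-eighths m)) (*≡* (identity (+ m))))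
  where
  identity : ∀ x → (+ 1 ℤ.* + 8 ℤ.+ x ℤ.* + 8) ℤ.* + 8 ≡ (+ 1 ℤ.+ x) ℤ.* + 64
  identity = ℤ-Solver.solve-∀

n/1≡mkℚ : ∀ n → + n / 1 ≡ mkℚ (+ n) 0 (coprime-sym (1-coprimeTo n))
n/1≡mkℚ n = ℚP.↥p/↧p≡p (mkℚ (+ n) 0 (coprime-sym (1-coprimeTo n)))

eighths-< : ∀ m n → 5 * m < 37 * n → sumℚ (replicate m eighth) ℚ.< (+ 925 / 1000) ℚ.* (+ n / 1)
eighths-< m n 5m<37n = ℚP.toℚᵘ-cancel-<
  (ℚᵘP.<-respˡ-≃ (ℚᵘP.≃-sym (toℚᵘ-eighths m))
    (ℚᵘP.<-respʳ-≃ (ℚᵘP.≃-sym (ℚP.toℚᵘ-homo-* (+ 925 / 1000) (+ n / 1))) below))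
  where
  scaled : m * 40 < (37 * n) * 8
  scaled = subst₂ _<_ (identity₁ m) (identity₂ n) (ℕP.*-monoʳ-< 8 5m<37n)
    where
    identity₁ : ∀ m → 8 * (5 * m) ≡ m * 40
    identity₁ = solve-∀
    identity₂ : ∀ n → 8 * (37 * n) ≡ (37 * n) * 8
    identity₂ = solve-∀
  below : mkℚᵘ (+ m) 7 ℚᵘ.< toℚᵘ (+ 925 / 1000) ℚᵘ.* toℚᵘ (+ n / 1)
  below rewrite n/1≡mkℚ n = *<* (subst₂ ℤ._<_ (ℤP.pos-* m 40)
    (trans (ℤP.pos-* (37 * n) 8) (cong (ℤ._* + 8) (ℤP.pos-* 37 n))) (+<+ scaled))

module Construction (w r : ℕ) where

  n : ℕ
  n = 4 * w + r

  outer central broad : List ℕ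
  outer   = iterate suc 0 w ++ iterate suc (3 * w + r) w
  central = iterate suc (2 * w) (4 * w + 2 * r)
  broad   = iterate suc w (6 * w + 2 * r)

  axial antis diags lines : List Line
  axial = (map row outer ++ map row outer) ++ (map col outer ++ map col outer)
  antis = map anti central ++ map anti broad
  diags = map (diag n) central ++ map (diag n) broad
  lines = axial ++ (antis ++ diags)

  central-span : 2 * w + (4 * w + 2 * r) + 2 * w ≡ n + n
  central-span = identity w r
    where
    identity : ∀ w r → 2 * w + (4 * w + 2 * r) + 2 * w ≡ (4 * w + r) + (4 * w + r)
    identity = solve-∀

  broad-span : w + (6 * w + 2 * r) + w ≡ n + n
  broad-span = identity w r
    where
    identity : ∀ w r → w + (6 * w + 2 * r) + w ≡ (4 * w + r) + (4 * w + r)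
    identity = solve-∀

  outer-span : 3 * w + r + w ≡ n
  outer-span = identity w r
    where
    identity : ∀ w r → 3 * w + r + w ≡ 4 * w + r
    identity = solve-∀

  w≤n : w ≤ n
  w≤n = ℕP.≤-trans (ℕP.m≤m+n w (3 * w)) (ℕP.m≤m+n (4 * w) r)

  All-outer : ∀ {P : ℕ → Set} → (∀ {t} → t < n → P t) → All P outer
  All-outer below =
    AllP.++⁺ (All-iterate-suc {a = 0} {w} (λ t<w → below (ℕP.<-≤-trans t<w w≤n)))
             (All-iterate-suc {a = 3 * w + r} {w} (λ {t} → below ∘ subst (t <_) outer-span))

  All-slanted : ∀ {P : ℕ → Set} {d len} → d + len + d ≡ n + n → (∀ {t} → t < n + n → P t) →
                All P (iterate suc d len)
  All-slanted {d = d} {len} span below = All-iterate-suc {a = d} {len}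
    (λ t< → below (ℕP.<-≤-trans t< (ℕP.≤-trans (ℕP.m≤m+n (d + len) d) (ℕP.≤-reflexive span))))

  lines-meet : All (MeetsBoard n) lines
  lines-meet =
    AllP.++⁺ (AllP.++⁺ (AllP.++⁺ rows rows) (AllP.++⁺ cols cols))
             (AllP.++⁺ (AllP.++⁺ (slanted {anti} {2 * w} (anti-meets {n}) central-span)
                                 (slanted {anti} {w} (anti-meets {n}) broad-span))
                       (AllP.++⁺ (slanted {diag n} {2 * w} (diag-meets {n}) central-span)
                                 (slanted {diag n} {w} (diag-meets {n}) broad-span)))
    where
    rows = AllP.map⁺ (All-outer (row-meets {n}))
    cols = AllP.map⁺ (All-outer (col-meets {n}))
    slanted : ∀ {f : ℕ → Line} {d len} → (∀ {t} → t < n + n → MeetsBoard n (f t)) →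
              d + len + d ≡ n + n → All (MeetsBoard n) (map f (iterate suc d len))
    slanted meets span = AllP.map⁺ (All-slanted span meets)

  singleton⊆outer : ∀ {x x'} → suc (x + x') ≡ n → Outer w x x' → iterate suc x 1 ⊆ outer
  singleton⊆outer _ (inj₁ x<w) = ++⁺ʳ _ (iterate-suc-⊆ z≤n x<w)
  singleton⊆outer {x} {x'} hx (inj₂ x'<w) = ++⁺ˡ _ (iterate-suc-⊆ lower upper)
    where
    lower : 3 * w + r ≤ x
    lower = ℕP.+-cancelʳ-≤ w (3 * w + r) x
      (ℕP.≤-trans (ℕP.≤-reflexive (trans outer-span (trans (sym hx) (sym (ℕP.+-suc x x')))))
                  (ℕP.+-monoʳ-≤ x x'<w))
    upper : 1 + x ≤ 3 * w + r + w
    upper = subst (suc x ≤_) (trans hx (sym outer-span)) (s≤s (ℕP.m≤m+n x x'))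

  module _ {a a' b b'} (ha : suc (a + a') ≡ n) (hb : suc (b + b') ≡ n) where

    rows-hits : Outer w b b' → 2 ≤ hits a b (map row outer ++ map row outer)
    rows-hits o = hits-⊆ (++⁺ once once) (row-pierces a b ∷ row-pierces a b ∷ [])
      where once = map⁺ row (singleton⊆outer hb o)

    cols-hits : Outer w a a' → 2 ≤ hits a b (map col outer ++ map col outer)
    cols-hits o = hits-⊆ (++⁺ once once) (col-pierces a b ∷ col-pierces a b ∷ [])
      where once = map⁺ col (singleton⊆outer ha o)

    axial-hits-either : Outer w a a' ⊎ Outer w b b' → 2 ≤ hits a b axial
    axial-hits-either (inj₁ oa) = hits-++-mono {xs = map row outer ++ map row outer} z≤n (cols-hits oa)
    axial-hits-either (inj₂ ob) = hits-++-mono {ys = map col outer ++ map col outer} (rows-hits ob) z≤n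

    axial-hits-both : Outer w a a' → Outer w b b' → 4 ≤ hits a b axial
    axial-hits-both oa ob = hits-++-mono (rows-hits ob) (cols-hits oa)

    anti-span : 2 + ((a + b) + (a' + b')) ≡ n + n
    anti-span = trans (identity a a' b b') (cong₂ _+_ ha hb)
      where
      identity : ∀ a a' b b' → 2 + ((a + b) + (a' + b')) ≡ (1 + (a + a')) + (1 + (b + b'))
      identity = solve-∀

    diag-span : 2 + ((a + b') + (a' + b)) ≡ n + n
    diag-span = trans (identity a a' b b') (cong₂ _+_ ha hb)
      where
      identity : ∀ a a' b b' → 2 + ((a + b') + (a' + b)) ≡ (1 + (a + a')) + (1 + (b + b'))
      identity = solve-∀

    anti-band-hits : ∀ {d len} → Band d (a + b) (a' + b') → d + len + d ≡ n + n →
                     2 ≤ hits a b (map anti (iterate suc d len))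
    anti-band-hits band span = band-hits anti band (trans anti-span (sym span))
      (anti-pierces {a} {b} ℕP.≤-refl (ℕP.n≤1+n _)) (anti-pierces {a} {b} (ℕP.n≤1+n _) ℕP.≤-refl)

    diag-band-hits : ∀ {d len} → Band d (a + b') (a' + b) → d + len + d ≡ n + n →
                     2 ≤ hits a b (map (diag n) (iterate suc d len))
    diag-band-hits band span = band-hits (diag n) band (trans diag-span (sym span))
      (diag-pierces {a = a} hb ℕP.≤-refl (ℕP.n≤1+n _))
      (diag-pierces {a = a} hb (ℕP.n≤1+n _) ℕP.≤-refl)

    Band-half : ∀ {s s'} → Band (2 * w) s s' → Band w s s'
    Band-half (l , r) = half≤ w l , half≤ w r

    antis-hits-central : Band (2 * w) (a + b) (a' + b') → 4 ≤ hits a b antis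
    antis-hits-central band =
      hits-++-mono (anti-band-hits band central-span) (anti-band-hits (Band-half band) broad-span)

    antis-hits-broad : Band w (a + b) (a' + b') → 2 ≤ hits a b antis
    antis-hits-broad band = hits-++-mono {xs = map anti central} z≤n (anti-band-hits band broad-span)

    diags-hits-central : Band (2 * w) (a + b') (a' + b) → 4 ≤ hits a b diags
    diags-hits-central band =
      hits-++-mono (diag-band-hits band central-span) (diag-band-hits (Band-half band) broad-span)

    diags-hits-broad : Band w (a + b') (a' + b) → 2 ≤ hits a b diags
    diags-hits-broad band = hits-++-mono {xs = map (diag n) central} z≤n (diag-band-hits band broad-span)

    covering-hits : Covering w a a' b b' → 8 ≤ hits a b lines
    covering-hits (interior anti diag) =
      hits-++-mono {xs = axial} z≤n (hits-++-mono (antis-hits-central anti) (diags-hits-central diag))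
    covering-hits (edge-anti o anti diag) =
      hits-++-mono (axial-hits-either o) (hits-++-mono (antis-hits-central anti) (diags-hits-broad diag))
    covering-hits (edge-diag o anti diag) =
      hits-++-mono (axial-hits-either o) (hits-++-mono (antis-hits-broad anti) (diags-hits-central diag))
    covering-hits (corner-anti oa ob anti) =
      hits-++-mono (axial-hits-both oa ob) (hits-++-mono {ys = diags} (antis-hits-central anti) z≤n)
    covering-hits (corner-diag oa ob diag) =
      hits-++-mono (axial-hits-both oa ob) (hits-++-mono {xs = antis} z≤n (diags-hits-central diag))

  lines-cover : ∀ {a b} → a < n → b < n → 8 ≤ hits a b lines
  lines-cover {a} {b} a<n b<n with ℕP.m≤n⇒∃[o]m+o≡n a<n | ℕP.m≤n⇒∃[o]m+o≡n b<n
  ... | a' , ha | b' , hb = covering-hits ha hb (covering (spread {a} {a'} ha) (spread {b} {b'} hb))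
    where
    spread : ∀ {x x'} → suc (x + x') ≡ n → 4 * w ≤ suc (x + x')
    spread h = subst (4 * w ≤_) (sym h) (ℕP.m≤m+n (4 * w) r)

  length-outer : length outer ≡ w + w
  length-outer = trans (length-++ (iterate suc 0 w))
    (cong₂ _+_ (length-iterate suc 0 w) (length-iterate suc (3 * w + r) w))

  length-axial : length axial ≡ (w + w) + (w + w) + ((w + w) + (w + w))
  length-axial = trans (length-++ (map row outer ++ map row outer))
    (cong₂ _+_ (trans (length-map-++ row row outer outer) (cong₂ _+_ length-outer length-outer))
               (trans (length-map-++ col col outer outer) (cong₂ _+_ length-outer length-outer)))

  length-slanted : ∀ f → length (map f central ++ map f broad) ≡ (4 * w + 2 * r) + (6 * w + 2 * r)
  length-slanted f = trans (length-map-++ f f central broad)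
    (cong₂ _+_ (length-iterate suc (2 * w) (4 * w + 2 * r)) (length-iterate suc w (6 * w + 2 * r)))

  length-lines : length lines ≡ 28 * w + 8 * r
  length-lines = trans (length-++ axial)
    (trans (cong₂ _+_ length-axial
                      (trans (length-++ antis) (cong₂ _+_ (length-slanted anti) (length-slanted (diag n)))))
           (identity w r))
    where
    identity : ∀ w r → (w + w) + (w + w) + ((w + w) + (w + w))
                       + ((4 * w + 2 * r) + (6 * w + 2 * r) + ((4 * w + 2 * r) + (6 * w + 2 * r)))
                       ≡ 28 * w + 8 * r
    identity = solve-∀

  weighting : Weighting
  weighting = uniform eighth lines

  weighting-admissible : All (λ e → MeetsBoard n (proj₁ e) × 0ℚ ℚ.≤ proj₂ e) weighting
  weighting-admissible = AllP.map⁺ (All.map (_, 0≤eighth) lines-meet)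

  weighting-covers : ∀ (i j : Fin n) → 1ℚ ℚ.≤ coverage weighting (toℕ i) (toℕ j)
  weighting-covers i j = subst (1ℚ ℚ.≤_) (sym (coverage-uniform eighth lines (toℕ i) (toℕ j)))
    (sumℚ-replicate-mono 0≤eighth (lines-cover (toℕ<n i) (toℕ<n j)))

  weighting-cheap : 3 * r < 8 * w → totalWeight weighting ℚ.< (+ 925 / 1000) ℚ.* (+ n / 1)
  weighting-cheap 3r<8w = subst (ℚ._< (+ 925 / 1000) ℚ.* (+ n / 1)) (sym (totalWeight-uniform eighth lines))
    (eighths-< (length lines) n (subst (λ m → 5 * m < 37 * n) (sym length-lines) budget))
    where
    budget : 5 * (28 * w + 8 * r) < 37 * (4 * w + r)
    budget = subst₂ _<_ (identity₁ w r) (identity₂ w r) (ℕP.+-monoʳ-< (140 * w + 37 * r) 3r<8w)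
      where
      identity₁ : ∀ w r → 140 * w + 37 * r + 3 * r ≡ 5 * (28 * w + 8 * r)
      identity₁ = solve-∀
      identity₂ : ∀ w r → 140 * w + 37 * r + 8 * w ≡ 37 * (4 * w + r)
      identity₂ = solve-∀

CheapCover : ℕ → Set
CheapCover n =
  ∃[ w ] (All (λ e → MeetsBoard n (proj₁ e) × 0ℚ ℚ.≤ proj₂ e) w
          × (∀ (i j : Fin n) → 1ℚ ℚ.≤ coverage w (toℕ i) (toℕ j))
          × totalWeight w ℚ.< (+ 925 / 1000) ℚ.* (+ n / 1))

cheapCover : ∀ {n} w r → 4 * w + r ≡ n → 3 * r < 8 * w → CheapCover n
cheapCover w r refl 3r<8w = weighting , weighting-admissible , weighting-covers , weighting-cheap 3r<8w
  where open Construction w r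

quarter-split : ∀ n → 4 * (n div 4) + n % 4 ≡ n
quarter-split n = trans (identity (n div 4) (n % 4)) (sym (m≡m%n+[m/n]*n n 4))
  where
  identity : ∀ q r → 4 * q + r ≡ r + q * 4
  identity = solve-∀

remainder-small : ∀ {n} → 8 ≤ n → 3 * (n % 4) < 8 * (n div 4)
remainder-small {n} 8≤n = ℕP.≤-<-trans (ℕP.*-monoʳ-≤ 3 (s≤s⁻¹ (m%n<n n 4)))
  (ℕP.<-≤-trans (ℕP.m<m+n 9 {7} (s≤s z≤n)) (ℕP.*-monoʳ-≤ 8 (/-monoˡ-≤ 4 8≤n)))

theorem4 : ∃[ N ] ∀ (n : ℕ) → N ≤ n →
    ∃[ w ] (All (λ e → MeetsBoard n (proj₁ e) × 0ℚ ℚ.≤ proj₂ e) w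
            × (∀ (i j : Fin n) → 1ℚ ℚ.≤ coverage w (toℕ i) (toℕ j))
            × totalWeight w ℚ.< (+ 925 / 1000) ℚ.* (+ n / 1))
theorem4 = 8 , λ n 8≤n → cheapCover (n div 4) (n % 4) (quarter-split n) (remainder-small 8≤n)
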